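{- Let $k\ge 3$ and $n\ge 1$ be integers and let $[a_0,\dots,a_{k-1}]$ represent a $k$-gon modulo $n$. Let $G=G(a_0,\dots,a_{k-1})=\langle\sigma_0,\sigma_1\rangle$ be its monodromy group. Set $N=\langle \sigma_0^x\sigma_1^x : 0<x<k\rangle$ and $H=\langle\sigma_0\rangle$. Then $G=N\rtimes H$, i.e. $N$ is a normal subgroup of $G$, $N\cap H=\{\mathrm{id}\}$ and $NH=G$.
   Context: A $k$-tuple of positive integers $[a_0,\dots,a_{k-1}]$ ($k\ge 3$) represents a (geometric) $k$-gon modulo $n$ if $a_0+\dots+a_{k-1}=(k-2)n$, $a_i<2n$ and $a_i\ne n$ for all $i$, and $\gcd(a_0,\dots,a_{k-1},n)=1$; it encodes a polygon with consecutive angles $a_i\pi/n$. Indices of the $a_i$ are read modulo $k$. The dessin d'enfant drawn on the rational billiards surface of this polygon has edge set identified with the set $\mathbb{Z}/n\mathbb{Z}\times\mathbb{Z}/k\mathbb{Z}$ (pairs $(m,i)$), and its monodromy group $G(a_0,\dots,a_{k-1})$ is the group of permutations of $\mathbb{Z}/n\mathbb{Z}\times\mathbb{Z}/k\mathbb{Z}$ generated by $\sigma_0(m,i)=(m,i+1)$ and $\sigma_1(m,i)=(m-a_{i-1},\,i-1)$. -}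

module Defs where

open import Data.Nat using (ℕ; zero; suc; _+_; _*_; _∸_; _<_; _≤_; NonZero)
open import Data.Nat.GCD using (gcd)
open import Data.Integer as ℤ using (ℤ; +_)
open import Data.Integer.DivMod using (_%ℕ_; n%ℕd<d)
open import Data.Fin using (Fin; toℕ; fromℕ<)
open import Data.List using (List; map; foldr; allFin)
open import Data.Nat.ListAction using (sum)
open import Data.Product using (_×_; _,_; ∃)
open import Data.Sum using (_⊎_)
open import Relation.Binary.PropositionalEquality using (_≡_)
open import Relation.Nullary using (¬_)
open import Function using (id; _∘_)

toZ/ : ℤ → (d : ℕ) .{{_ : NonZero d}} → Fin d
toZ/ z d = fromℕ< (n%ℕd<d z d)

sumFin : (k : ℕ) → (Fin k → ℕ) → ℕ
sumFin k a = sum (map a (allFin k))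

gcdFam : (k : ℕ) → (Fin k → ℕ) → ℕ → ℕ
gcdFam k a n = foldr gcd n (map a (allFin k))

record IsKGon (n k : ℕ) (a : Fin k → ℕ) : Set where
  field
    positive  : ∀ i → 0 < a i
    angleSum  : sumFin k a ≡ (k ∸ 2) * n
    lt2n      : ∀ i → a i < 2 * n
    neqn      : ∀ i → ¬ (a i ≡ n)
    coprime   : gcdFam k a n ≡ 1

Edge : ℕ → ℕ → Set
Edge n k = Fin n × Fin k

module _ (n k : ℕ) .{{_ : NonZero n}} .{{_ : NonZero k}} (a : Fin k → ℕ) where

  σ₀ : Edge n k → Edge n k
  σ₀ (m , i) = m , toZ/ (+ toℕ i ℤ.+ + 1) k

  σ₁ : Edge n k → Edge n k
  σ₁ (m , i) = let j = toZ/ (+ toℕ i ℤ.- + 1) k in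
               toZ/ (+ toℕ m ℤ.- + a j) n , j

_^_ : {X : Set} → (X → X) → ℕ → (X → X)
f ^ zero  = id
f ^ suc x = f ∘ (f ^ x)

-- Subgroup of Sym(X) generated by a set S of permutations of X:
-- the smallest set of maps containing S and id, closed under
-- composition, inverses, and pointwise equality of maps.
data ⟨_⟩ {X : Set} (S : (X → X) → Set) : (X → X) → Set where
  gen  : ∀ {f} → S f → ⟨ S ⟩ f
  one  : ⟨ S ⟩ id
  comp : ∀ {f g} → ⟨ S ⟩ f → ⟨ S ⟩ g → ⟨ S ⟩ (f ∘ g)
  inv  : ∀ {f g} → ⟨ S ⟩ f → (∀ x → g (f x) ≡ x) → (∀ x → f (g x) ≡ x) → ⟨ S ⟩ g
  ext  : ∀ {f g} → ⟨ S ⟩ f → (∀ x → f x ≡ g x) → ⟨ S ⟩ g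

module _ (n k : ℕ) .{{_ : NonZero n}} .{{_ : NonZero k}} (a : Fin k → ℕ) where

  MonodromyGroup : (Edge n k → Edge n k) → Set
  MonodromyGroup = ⟨ (λ f → f ≡ σ₀ n k a ⊎ f ≡ σ₁ n k a) ⟩

  NSub : (Edge n k → Edge n k) → Set
  NSub = ⟨ (λ f → ∃ λ x → 0 < x × x < k × f ≡ (σ₀ n k a ^ x) ∘ (σ₁ n k a ^ x)) ⟩

  HSub : (Edge n k → Edge n k) → Set
  HSub = ⟨ (λ f → f ≡ σ₀ n k a) ⟩

-- Both generators have order dividing k: σ₀ rotates the index i, and a full
-- turn of σ₁ shifts the position m by the angle sum (k − 2) n ≡ 0 (mod n).
-- For any s, t with sᵏ = tᵏ = id, conjugating a generator sˣ tˣ of N by s gives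
-- sˣ⁺¹ tˣ⁺¹ (s t)⁻¹ ∈ N, and t = (t s) sᵏ⁻¹ with t s ∈ N; hence every element of
-- G = ⟨s, t⟩ factors as f sᵘ with f ∈ N, which gives both normality and G = N H.
-- Finally N fixes the index (σ₀ and σ₁ move it by +1 and −1) while H fixes the
-- position, so N ∩ H is trivial.

module Submission where

open import Defs
open import Data.Nat as ℕ using (ℕ; zero; suc; _≤_; _<_; s≤s; z≤n; _∸_; NonZero)
import Data.Nat.Properties as ℕP
import Data.Nat.DivMod as ℕD
open import Data.Integer as ℤ using (ℤ; +_; -[1+_]; _%ℕ_; _/ℕ_)
import Data.Integer.Properties as ℤP
open import Data.Integer.DivMod using (n%ℕd<d; a≡a%ℕn+[a/ℕn]*n)
open import Data.Integer.Tactic.RingSolver using (solve-∀)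
open import Data.Fin as F using (Fin; toℕ)
import Data.Fin.Properties as FP
open import Data.List using (tabulate)
open import Data.List.Properties using (map-tabulate)
open import Data.Nat.ListAction using (sum)
open import Data.Product using (_×_; _,_; ∃; ∃₂; proj₁; proj₂)
open import Data.Sum using (_⊎_; inj₁; inj₂)
open import Function using (id; _∘_)
open import Relation.Binary.PropositionalEquality
  using (_≡_; _≗_; refl; sym; trans; cong; cong₂; subst; module ≡-Reasoning)
open import Relation.Nullary using (yes; no; contradiction)

module _ {X : Set} (f : X → X) where

  ^-sucʳ : ∀ t → f ^ suc t ≗ f ^ t ∘ f
  ^-sucʳ zero    x = refl
  ^-sucʳ (suc t) x = cong f (^-sucʳ t x)

  ^-+ : ∀ s t → f ^ (s ℕ.+ t) ≗ f ^ s ∘ f ^ t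
  ^-+ zero    t x = refl
  ^-+ (suc s) t x = cong f (^-+ s t x)

  ^-* : ∀ s t → (f ^ s) ^ t ≗ f ^ (t ℕ.* s)
  ^-* s zero    x = refl
  ^-* s (suc t) x = trans (cong (f ^ s) (^-* s t x)) (sym (^-+ s (t ℕ.* s) x))

^-inverseˡ : {X : Set} {f g : X → X} → g ∘ f ≗ id → ∀ t → g ^ t ∘ f ^ t ≗ id
^-inverseˡ         gf zero    x = refl
^-inverseˡ {f = f} {g} gf (suc t) x = begin
  (g ^ suc t) ((f ^ suc t) x) ≡⟨ ^-sucʳ g t _ ⟩
  (g ^ t) (g (f ((f ^ t) x))) ≡⟨ cong (g ^ t) (gf _) ⟩
  (g ^ t) ((f ^ t) x)         ≡⟨ ^-inverseˡ gf t x ⟩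
  x                           ∎
  where open ≡-Reasoning

module _ {X : Set} where

  ⟨⟩-mono : ∀ {S T : (X → X) → Set} → (∀ {f} → S f → ⟨ T ⟩ f) → ∀ {f} → ⟨ S ⟩ f → ⟨ T ⟩ f
  ⟨⟩-mono S⊆T (gen p)       = S⊆T p
  ⟨⟩-mono S⊆T one           = one
  ⟨⟩-mono S⊆T (comp p q)    = comp (⟨⟩-mono S⊆T p) (⟨⟩-mono S⊆T q)
  ⟨⟩-mono S⊆T (inv p gf fg) = inv (⟨⟩-mono S⊆T p) gf fg
  ⟨⟩-mono S⊆T (ext p f≗g)   = ext (⟨⟩-mono S⊆T p) f≗g

  ⟨⟩-^ : ∀ {S : (X → X) → Set} {f} → ⟨ S ⟩ f → ∀ t → ⟨ S ⟩ (f ^ t)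
  ⟨⟩-^ p zero    = one
  ⟨⟩-^ p (suc t) = comp p (⟨⟩-^ p t)

  ⟨⟩-preserves : ∀ {S : (X → X) → Set} {Y : Set} (π : X → Y) →
                 (∀ {f} → S f → π ∘ f ≗ π) → ∀ {f} → ⟨ S ⟩ f → π ∘ f ≗ π
  ⟨⟩-preserves π hyp (gen p)                  x = hyp p x
  ⟨⟩-preserves π hyp one                      x = refl
  ⟨⟩-preserves π hyp (comp {g = g} p q)       x = trans (⟨⟩-preserves π hyp p (g x)) (⟨⟩-preserves π hyp q x)
  ⟨⟩-preserves π hyp (inv {g = g} p gf fg)    x = trans (sym (⟨⟩-preserves π hyp p (g x))) (cong π (fg x))
  ⟨⟩-preserves π hyp (ext p f≗g)              x = trans (cong π (sym (f≗g x))) (⟨⟩-preserves π hyp p x)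

  module _ {S : (X → X) → Set} {c c⁻¹ : X → X} (c⁻¹c : c⁻¹ ∘ c ≗ id) (cc⁻¹ : c ∘ c⁻¹ ≗ id)
           (conj-gen : ∀ {f} → S f → ⟨ S ⟩ (c ∘ f ∘ c⁻¹)) where

    ⟨⟩-conj : ∀ {f} → ⟨ S ⟩ f → ⟨ S ⟩ (c ∘ f ∘ c⁻¹)
    ⟨⟩-conj (gen p)              = conj-gen p
    ⟨⟩-conj one                  = ext one (sym ∘ cc⁻¹)
    ⟨⟩-conj (comp {f} {g} p q)   = ext (comp (⟨⟩-conj p) (⟨⟩-conj q)) (λ x → cong (c ∘ f) (c⁻¹c (g (c⁻¹ x))))
    ⟨⟩-conj (inv {f} {g} p gf fg) = inv (⟨⟩-conj p)
      (λ x → trans (cong (c ∘ g) (c⁻¹c (f (c⁻¹ x)))) (trans (cong c (gf (c⁻¹ x))) (cc⁻¹ x)))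
      (λ x → trans (cong (c ∘ f) (c⁻¹c (g (c⁻¹ x)))) (trans (cong c (fg (c⁻¹ x))) (cc⁻¹ x)))
    ⟨⟩-conj (ext p f≗g)          = ext (⟨⟩-conj p) (λ x → cong c (f≗g (c⁻¹ x)))

module Semidirect {X : Set} (s t : X → X) (k₂ : ℕ)
                  (s-period : s ^ suc (suc k₂) ≗ id) (t-period : t ^ suc (suc k₂) ≗ id) where

  k : ℕ
  k = suc (suc k₂)

  G N H : (X → X) → Set
  G = ⟨ (λ f → f ≡ s ⊎ f ≡ t) ⟩
  N = ⟨ (λ f → ∃ λ x → 0 < x × x < k × f ≡ (s ^ x) ∘ (t ^ x)) ⟩
  H = ⟨ (λ f → f ≡ s) ⟩

  s⁻¹ t⁻¹ : X → X
  s⁻¹ = s ^ suc k₂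
  t⁻¹ = t ^ suc k₂

  s∘s⁻¹ : s ∘ s⁻¹ ≗ id
  s∘s⁻¹ = s-period

  s⁻¹∘s : s⁻¹ ∘ s ≗ id
  s⁻¹∘s x = trans (sym (^-sucʳ s (suc k₂) x)) (s-period x)

  t∘t⁻¹ : t ∘ t⁻¹ ≗ id
  t∘t⁻¹ = t-period

  t⁻¹∘t : t⁻¹ ∘ t ≗ id
  t⁻¹∘t x = trans (sym (^-sucʳ t (suc k₂) x)) (t-period x)

  N⊆G : ∀ {f} → N f → G f
  N⊆G = ⟨⟩-mono λ { (x , _ , _ , refl) → comp (⟨⟩-^ (gen (inj₁ refl)) x) (⟨⟩-^ (gen (inj₂ refl)) x) }

  H⊆G : ∀ {f} → H f → G f
  H⊆G = ⟨⟩-mono λ { refl → gen (inj₁ refl) }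

  N-gen : ∀ x → 0 < x → x < k → N (s ^ x ∘ t ^ x)
  N-gen x 0<x x<k = gen (x , 0<x , x<k , refl)

  N-t⁻¹∘s⁻¹ : N (t⁻¹ ∘ s⁻¹)
  N-t⁻¹∘s⁻¹ = inv (N-gen 1 (s≤s z≤n) (s≤s (s≤s z≤n)))
    (λ x → trans (cong t⁻¹ (s⁻¹∘s (t x))) (t⁻¹∘t x))
    (λ x → trans (cong s (t∘t⁻¹ (s⁻¹ x))) (s∘s⁻¹ x))

  N-t∘s : N (t ∘ s)
  N-t∘s = inv (N-gen (suc k₂) (s≤s z≤n) ℕP.≤-refl)
    (λ x → trans (cong t (s∘s⁻¹ (t⁻¹ x))) (t∘t⁻¹ x))
    (λ x → trans (cong s⁻¹ (t⁻¹∘t (s x))) (s⁻¹∘s x))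

  -- s (sˣ tˣ) s⁻¹ = (sˣ⁺¹ tˣ⁺¹) (s t)⁻¹, and sᵏ tᵏ = id.
  N-conj-s : ∀ {f} → N f → N (s ∘ f ∘ s⁻¹)
  N-conj-s = ⟨⟩-conj {c = s} {s⁻¹} s⁻¹∘s s∘s⁻¹ conj-gen
    where
    conj-gen : ∀ {f} → (∃ λ x → 0 < x × x < k × f ≡ (s ^ x) ∘ (t ^ x)) → N (s ∘ f ∘ s⁻¹)
    conj-gen (x , _ , x<k , refl) with suc x ℕP.<? k
    ... | yes 1+x<k = ext (comp (N-gen (suc x) (s≤s z≤n) 1+x<k) N-t⁻¹∘s⁻¹)
            (λ y → cong (s ∘ s ^ x) (trans (^-sucʳ t x _) (cong (t ^ x) (t∘t⁻¹ (s⁻¹ y)))))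
    ... | no 1+x≮k with ℕP.≤-antisym x<k (ℕP.≮⇒≥ 1+x≮k)
    ...   | refl = ext N-t⁻¹∘s⁻¹ (λ y → sym (s-period _))

  N-conj-s^ : ∀ u {f} → N f → N (s ^ u ∘ f ∘ s⁻¹ ^ u)
  N-conj-s^ zero    p = p
  N-conj-s^ (suc u) {f} p =
    ext (N-conj-s (N-conj-s^ u p)) (λ x → cong (s ∘ s ^ u ∘ f) (sym (^-sucʳ s⁻¹ u x)))

  N-factor⁻¹ : ∀ {h h⁻¹ f} u → h⁻¹ ∘ h ≗ id → h ∘ h⁻¹ ≗ id → N f → h ≗ f ∘ s ^ u → N (s ^ u ∘ h⁻¹)
  N-factor⁻¹ {h} {h⁻¹} {f} u h⁻¹h hh⁻¹ p h≗fsᵘ = inv p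
    (λ y → begin
      (s ^ u) (h⁻¹ (f y))                       ≡⟨ cong (s ^ u ∘ h⁻¹ ∘ f) (^-inverseˡ s∘s⁻¹ u y) ⟨
      (s ^ u) (h⁻¹ (f ((s ^ u) ((s⁻¹ ^ u) y)))) ≡⟨ cong (s ^ u ∘ h⁻¹) (h≗fsᵘ _) ⟨
      (s ^ u) (h⁻¹ (h ((s⁻¹ ^ u) y)))           ≡⟨ cong (s ^ u) (h⁻¹h _) ⟩
      (s ^ u) ((s⁻¹ ^ u) y)                     ≡⟨ ^-inverseˡ s∘s⁻¹ u y ⟩
      y                                         ∎)
    (λ x → trans (sym (h≗fsᵘ (h⁻¹ x))) (hh⁻¹ x))
    where open ≡-Reasoning

  NH-factorisation : ∀ {h} → G h → ∃₂ λ f u → N f × h ≗ f ∘ s ^ u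
  NH-factorisation (gen (inj₁ refl)) = id , 1 , one , λ _ → refl
  NH-factorisation (gen (inj₂ refl)) = t ∘ s , suc k₂ , N-t∘s , λ x → cong t (sym (s∘s⁻¹ x))
  NH-factorisation one = id , 0 , one , λ _ → refl
  NH-factorisation (comp {h₁} {h₂} p q) with NH-factorisation p | NH-factorisation q
  ... | f₁ , u₁ , n₁ , e₁ | f₂ , u₂ , n₂ , e₂ =
    f₁ ∘ s ^ u₁ ∘ f₂ ∘ s⁻¹ ^ u₁ , u₁ ℕ.+ u₂ , comp n₁ (N-conj-s^ u₁ n₂) , λ x → begin
      h₁ (h₂ x)                                               ≡⟨ e₁ (h₂ x) ⟩
      f₁ ((s ^ u₁) (h₂ x))                                    ≡⟨ cong (f₁ ∘ s ^ u₁) (e₂ x) ⟩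
      f₁ ((s ^ u₁) (f₂ ((s ^ u₂) x)))                         ≡⟨ cong (f₁ ∘ s ^ u₁ ∘ f₂) (^-inverseˡ s⁻¹∘s u₁ _) ⟨
      f₁ ((s ^ u₁) (f₂ ((s⁻¹ ^ u₁) ((s ^ u₁) ((s ^ u₂) x))))) ≡⟨ cong (f₁ ∘ s ^ u₁ ∘ f₂ ∘ s⁻¹ ^ u₁) (^-+ s u₁ u₂ x) ⟨
      f₁ ((s ^ u₁) (f₂ ((s⁻¹ ^ u₁) ((s ^ (u₁ ℕ.+ u₂)) x))))   ∎
    where open ≡-Reasoning
  NH-factorisation (inv {h} {g} p gh hg) with NH-factorisation p
  ... | f , u , nf , e =
    s ^ v ∘ f⁻¹ ∘ s⁻¹ ^ v , v , N-conj-s^ v (N-factor⁻¹ u gh hg nf e) , λ x → begin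
      g x                                   ≡⟨ ^-inverseˡ s⁻¹∘s u (g x) ⟨
      (s⁻¹ ^ u) ((s ^ u) (g x))             ≡⟨ ^-* s (suc k₂) u _ ⟩
      (s ^ v) (f⁻¹ x)                       ≡⟨ cong (s ^ v ∘ f⁻¹) (^-inverseˡ s⁻¹∘s v x) ⟨
      (s ^ v) (f⁻¹ ((s⁻¹ ^ v) ((s ^ v) x))) ∎
    where
    open ≡-Reasoning
    v : ℕ
    v = u ℕ.* suc k₂
    f⁻¹ : X → X
    f⁻¹ = s ^ u ∘ g
  NH-factorisation (ext p h≗g) with NH-factorisation p
  ... | f , u , nf , e = f , u , nf , λ x → trans (sym (h≗g x)) (e x)

  G⊆NH : ∀ {h} → G h → ∃₂ λ f g → N f × H g × h ≗ f ∘ g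
  G⊆NH p with NH-factorisation p
  ... | f , u , nf , e = f , s ^ u , nf , ⟨⟩-^ (gen refl) u , e

  N-normal : ∀ {g g⁻¹ f} → G g → g⁻¹ ∘ g ≗ id → g ∘ g⁻¹ ≗ id → N f → N (g ∘ f ∘ g⁻¹)
  N-normal {g} {g⁻¹} {f} p g⁻¹g gg⁻¹ nf with NH-factorisation p
  ... | f′ , u , nf′ , e =
    ext (comp nf′ (comp (N-conj-s^ u nf) (N-factor⁻¹ u g⁻¹g gg⁻¹ nf′ e))) λ x →
      trans (cong (f′ ∘ s ^ u ∘ f) (^-inverseˡ s⁻¹∘s u (g⁻¹ x))) (sym (e (f (g⁻¹ x))))

module Modular (n : ℕ) .{{_ : NonZero n}} where

  private
    pos-+-* : ∀ r q → + r ℤ.+ + q ℤ.* + n ≡ + (r ℕ.+ q ℕ.* n)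
    pos-+-* r q = sym (trans (ℤP.pos-+ r (q ℕ.* n)) (cong (ℤ._+_ (+ r)) (ℤP.pos-* q n)))

    remainder-uniqueℕ : ∀ {r r′} q → r < n → r ≡ r′ ℕ.+ q ℕ.* n → r ≡ r′
    remainder-uniqueℕ {r′ = r′} zero    _   r≡ = trans r≡ (ℕP.+-identityʳ r′)
    remainder-uniqueℕ {r} {r′} (suc q) r<n r≡ = contradiction n≤r (ℕP.<⇒≱ r<n)
      where
      n≤r : n ≤ r
      n≤r = subst (n ≤_) (sym r≡) (ℕP.≤-trans (ℕP.m≤m+n n (q ℕ.* n)) (ℕP.m≤n+m _ r′))

  remainder-unique : ∀ {r r′} q → r < n → r′ < n → + r ≡ + r′ ℤ.+ q ℤ.* + n → r ≡ r′
  remainder-unique {r′ = r′} (+ q) r<n _ r≡ =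
    remainder-uniqueℕ q r<n (ℤP.+-injective (trans r≡ (pos-+-* r′ q)))
  remainder-unique {r} {r′} -[1+ q ] _ r′<n r≡ =
    sym (remainder-uniqueℕ (suc q) r′<n (ℤP.+-injective (trans r′≡ (pos-+-* r (suc q)))))
    where
    cancel : ∀ R Q M → R ≡ (R ℤ.+ (ℤ.- Q) ℤ.* M) ℤ.+ Q ℤ.* M
    cancel = solve-∀
    r′≡ : + r′ ≡ + r ℤ.+ + suc q ℤ.* + n
    r′≡ = trans (cancel (+ r′) (+ suc q) (+ n)) (cong (ℤ._+ + suc q ℤ.* + n) (sym r≡))

  [i+qn]%ℕn≡i%ℕn : ∀ i q → (i ℤ.+ q ℤ.* + n) %ℕ n ≡ i %ℕ n
  [i+qn]%ℕn≡i%ℕn i q =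
    remainder-unique (i /ℕ n ℤ.+ q ℤ.- j /ℕ n) (n%ℕd<d j n) (n%ℕd<d i n) (begin
      + (j %ℕ n)                                       ≡⟨ cancel (+ (j %ℕ n)) (j /ℕ n) (+ n) ⟩
      + (j %ℕ n) ℤ.+ j /ℕ n ℤ.* + n ℤ.- j /ℕ n ℤ.* + n ≡⟨ cong (ℤ._- j /ℕ n ℤ.* + n) (a≡a%ℕn+[a/ℕn]*n j n) ⟨
      i ℤ.+ q ℤ.* + n ℤ.- j /ℕ n ℤ.* + n               ≡⟨ cong (λ w → w ℤ.+ q ℤ.* + n ℤ.- j /ℕ n ℤ.* + n) (a≡a%ℕn+[a/ℕn]*n i n) ⟩
      + (i %ℕ n) ℤ.+ i /ℕ n ℤ.* + n ℤ.+ q ℤ.* + n ℤ.- j /ℕ n ℤ.* + n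
                                                       ≡⟨ collect (+ (i %ℕ n)) (i /ℕ n) q (j /ℕ n) (+ n) ⟩
      + (i %ℕ n) ℤ.+ (i /ℕ n ℤ.+ q ℤ.- j /ℕ n) ℤ.* + n ∎)
    where
    open ≡-Reasoning
    j : ℤ
    j = i ℤ.+ q ℤ.* + n
    cancel : ∀ R Q M → R ≡ R ℤ.+ Q ℤ.* M ℤ.- Q ℤ.* M
    cancel = solve-∀
    collect : ∀ R P Q S M → R ℤ.+ P ℤ.* M ℤ.+ Q ℤ.* M ℤ.- S ℤ.* M ≡ R ℤ.+ (P ℤ.+ Q ℤ.- S) ℤ.* M
    collect = solve-∀

  [i%ℕn-b]%ℕn≡[i-b]%ℕn : ∀ i b → (+ (i %ℕ n) ℤ.- b) %ℕ n ≡ (i ℤ.- b) %ℕ n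
  [i%ℕn-b]%ℕn≡[i-b]%ℕn i b = begin
    (+ (i %ℕ n) ℤ.- b) %ℕ n                    ≡⟨ [i+qn]%ℕn≡i%ℕn (+ (i %ℕ n) ℤ.- b) (i /ℕ n) ⟨
    (+ (i %ℕ n) ℤ.- b ℤ.+ i /ℕ n ℤ.* + n) %ℕ n ≡⟨ cong (_%ℕ n) (swap (+ (i %ℕ n)) b (i /ℕ n) (+ n)) ⟩
    (+ (i %ℕ n) ℤ.+ i /ℕ n ℤ.* + n ℤ.- b) %ℕ n ≡⟨ cong (λ w → (w ℤ.- b) %ℕ n) (a≡a%ℕn+[a/ℕn]*n i n) ⟨
    (i ℤ.- b) %ℕ n                             ∎
    where
    open ≡-Reasoning
    swap : ∀ R B Q M → R ℤ.- B ℤ.+ Q ℤ.* M ≡ R ℤ.+ Q ℤ.* M ℤ.- B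
    swap = solve-∀

  [m-qn]%ℕn≡m : ∀ {m} q → m < n → (+ m ℤ.- + (q ℕ.* n)) %ℕ n ≡ m
  [m-qn]%ℕn≡m {m} q m<n = begin
    (+ m ℤ.- + (q ℕ.* n)) %ℕ n     ≡⟨ cong (λ w → (+ m ℤ.- w) %ℕ n) (ℤP.pos-* q n) ⟩
    (+ m ℤ.- + q ℤ.* + n) %ℕ n     ≡⟨ cong (_%ℕ n) (neg-* (+ m) (+ q) (+ n)) ⟩
    (+ m ℤ.+ ℤ.- + q ℤ.* + n) %ℕ n ≡⟨ [i+qn]%ℕn≡i%ℕn (+ m) (ℤ.- + q) ⟩
    m ℕ.% n                        ≡⟨ ℕD.m<n⇒m%n≡m m<n ⟩
    m                              ∎
    where
    open ≡-Reasoning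
    neg-* : ∀ R Q M → R ℤ.- Q ℤ.* M ≡ R ℤ.+ ℤ.- Q ℤ.* M
    neg-* = solve-∀

module Cyclic (k₂ : ℕ) where

  k : ℕ
  k = suc (suc k₂)

  next prev : Fin k → Fin k
  next i = toZ/ (+ toℕ i ℤ.+ + 1) k
  prev i = toZ/ (+ toℕ i ℤ.- + 1) k

  residue : ℕ → Fin k
  residue j = toZ/ (+ j) k

  toℕ-residue : ∀ j → toℕ (residue j) ≡ j ℕ.% k
  toℕ-residue j = FP.toℕ-fromℕ< _

  residue-toℕ : ∀ i → residue (toℕ i) ≡ i
  residue-toℕ i = FP.toℕ-injective (trans (toℕ-residue (toℕ i)) (ℕD.m<n⇒m%n≡m (FP.toℕ<n i)))

  residue-+k : ∀ j → residue (j ℕ.+ k) ≡ residue j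
  residue-+k j = FP.toℕ-injective (begin
    toℕ (residue (j ℕ.+ k)) ≡⟨ toℕ-residue (j ℕ.+ k) ⟩
    (j ℕ.+ k) ℕ.% k         ≡⟨ ℕD.[m+n]%n≡m%n j k ⟩
    j ℕ.% k                 ≡⟨ toℕ-residue j ⟨
    toℕ (residue j)         ∎)
    where open ≡-Reasoning

  next-residue : ∀ j → next (residue j) ≡ residue (suc j)
  next-residue j = FP.toℕ-injective (begin
    toℕ (next (residue j))        ≡⟨ FP.toℕ-fromℕ< _ ⟩
    (toℕ (residue j) ℕ.+ 1) ℕ.% k ≡⟨ cong (λ r → (r ℕ.+ 1) ℕ.% k) (toℕ-residue j) ⟩
    (j ℕ.% k ℕ.+ 1 ℕ.% k) ℕ.% k   ≡⟨ ℕD.%-distribˡ-+ j 1 k ⟨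
    (j ℕ.+ 1) ℕ.% k               ≡⟨ cong (ℕ._% k) (ℕP.+-comm j 1) ⟩
    suc j ℕ.% k                   ≡⟨ toℕ-residue (suc j) ⟨
    toℕ (residue (suc j))             ∎)
    where open ≡-Reasoning

  next^-residue : ∀ t j → (next ^ t) (residue j) ≡ residue (j ℕ.+ t)
  next^-residue zero    j = cong residue (sym (ℕP.+-identityʳ j))
  next^-residue (suc t) j = begin
    next ((next ^ t) (residue j)) ≡⟨ cong next (next^-residue t j) ⟩
    next (residue (j ℕ.+ t))      ≡⟨ next-residue (j ℕ.+ t) ⟩
    residue (suc (j ℕ.+ t))       ≡⟨ cong residue (ℕP.+-suc j t) ⟨
    residue (j ℕ.+ suc t)         ∎
    where open ≡-Reasoning

  next-period : next ^ k ≗ id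
  next-period i = begin
    (next ^ k) i                 ≡⟨ cong (next ^ k) (residue-toℕ i) ⟨
    (next ^ k) (residue (toℕ i)) ≡⟨ next^-residue k (toℕ i) ⟩
    residue (toℕ i ℕ.+ k)        ≡⟨ residue-+k (toℕ i) ⟩
    residue (toℕ i)              ≡⟨ residue-toℕ i ⟩
    i                            ∎
    where open ≡-Reasoning

  prev-zero : prev F.zero ≡ residue (suc k₂)
  prev-zero = FP.toℕ-injective (trans (FP.toℕ-fromℕ< (n%ℕd<d -[1+ 0 ] k))
    (sym (trans (toℕ-residue (suc k₂)) (ℕD.m<n⇒m%n≡m (ℕP.n<1+n (suc k₂))))))

  next∘prev : next ∘ prev ≗ id
  next∘prev F.zero    = trans (cong next prev-zero) (trans (next-residue (suc k₂)) (residue-+k 0))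
  next∘prev (F.suc i) = trans (next-residue (toℕ i)) (residue-toℕ (F.suc i))

  prev-period : prev ^ k ≗ id
  prev-period i = trans (sym (next-period ((prev ^ k) i))) (^-inverseˡ {f = prev} {next} next∘prev k i)

  module _ (a : Fin k → ℕ) where

    forward-sum : ℕ → Fin k → ℕ
    forward-sum zero    i = 0
    forward-sum (suc L) i = a i ℕ.+ forward-sum L (next i)

    backward-sum : ℕ → Fin k → ℕ
    backward-sum zero    i = 0
    backward-sum (suc L) i = backward-sum L i ℕ.+ a (prev ((prev ^ L) i))

    backward-sum≡forward-sum : ∀ L i → backward-sum L i ≡ forward-sum L ((prev ^ L) i)
    backward-sum≡forward-sum zero    i = refl
    backward-sum≡forward-sum (suc L) i = trans (ℕP.+-comm (backward-sum L i) _)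
      (cong (a ((prev ^ suc L) i) ℕ.+_)
        (trans (backward-sum≡forward-sum L i) (cong (forward-sum L) (sym (next∘prev _)))))

    forward-sum-snoc : ∀ L i → forward-sum (suc L) i ≡ forward-sum L i ℕ.+ a ((next ^ L) i)
    forward-sum-snoc zero    i = ℕP.+-comm (a i) 0
    forward-sum-snoc (suc L) i = begin
      a i ℕ.+ forward-sum (suc L) (next i)                         ≡⟨ cong (a i ℕ.+_) (forward-sum-snoc L (next i)) ⟩
      a i ℕ.+ (forward-sum L (next i) ℕ.+ a ((next ^ L) (next i))) ≡⟨ cong (λ j → a i ℕ.+ (forward-sum L (next i) ℕ.+ a j)) (^-sucʳ next L i) ⟨
      a i ℕ.+ (forward-sum L (next i) ℕ.+ a ((next ^ suc L) i))    ≡⟨ ℕP.+-assoc (a i) _ _ ⟨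
      forward-sum (suc L) i ℕ.+ a ((next ^ suc L) i)               ∎
      where open ≡-Reasoning

    forward-sum-next : ∀ i → forward-sum k (next i) ≡ forward-sum k i
    forward-sum-next i = begin
      forward-sum k (next i)                                         ≡⟨ forward-sum-snoc (suc k₂) (next i) ⟩
      forward-sum (suc k₂) (next i) ℕ.+ a ((next ^ suc k₂) (next i)) ≡⟨ cong (λ j → forward-sum (suc k₂) (next i) ℕ.+ a j) full-turn ⟩
      forward-sum (suc k₂) (next i) ℕ.+ a i                          ≡⟨ ℕP.+-comm _ (a i) ⟩
      forward-sum k i                                                ∎
      where
      open ≡-Reasoning
      full-turn : (next ^ suc k₂) (next i) ≡ i
      full-turn = trans (sym (^-sucʳ next (suc k₂) i)) (next-period i)

    forward-sum-residue : ∀ j → forward-sum k (residue j) ≡ forward-sum k (residue 0)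
    forward-sum-residue zero    = refl
    forward-sum-residue (suc j) =
      trans (cong (forward-sum k) (sym (next-residue j))) (trans (forward-sum-next _) (forward-sum-residue j))

    sum-tabulate≡forward-sum : ∀ L j (g : Fin L → ℕ) → (∀ t → g t ≡ a (residue (j ℕ.+ toℕ t))) →
                               sum (tabulate g) ≡ forward-sum L (residue j)
    sum-tabulate≡forward-sum zero    j g g≡ = refl
    sum-tabulate≡forward-sum (suc L) j g g≡ = cong₂ ℕ._+_
      (trans (g≡ F.zero) (cong (a ∘ residue) (ℕP.+-identityʳ j)))
      (trans (sum-tabulate≡forward-sum L (suc j) (g ∘ F.suc) (λ t → trans (g≡ (F.suc t)) (cong (a ∘ residue) (ℕP.+-suc j (toℕ t)))))
             (cong (forward-sum L) (sym (next-residue j))))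

    sumFin≡backward-sum : ∀ i → sumFin k a ≡ backward-sum k i
    sumFin≡backward-sum i = begin
      sumFin k a                      ≡⟨ cong sum (map-tabulate id a) ⟩
      sum (tabulate a)                ≡⟨ sum-tabulate≡forward-sum k 0 a (λ t → cong a (sym (residue-toℕ t))) ⟩
      forward-sum k (residue 0)       ≡⟨ forward-sum-residue (toℕ i) ⟨
      forward-sum k (residue (toℕ i)) ≡⟨ cong (forward-sum k) (residue-toℕ i) ⟩
      forward-sum k i                 ≡⟨ cong (forward-sum k) (prev-period i) ⟨
      forward-sum k ((prev ^ k) i)    ≡⟨ backward-sum≡forward-sum k i ⟨
      backward-sum k i                ∎
      where open ≡-Reasoning

module Polygon (n : ℕ) .{{_ : NonZero n}} (k₂ : ℕ) (a : Fin (suc (suc k₂)) → ℕ) where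

  open Cyclic k₂
  open Modular n

  σ₀^-apply : ∀ u z → (σ₀ n k a ^ u) z ≡ (proj₁ z , (next ^ u) (proj₂ z))
  σ₀^-apply zero    z = refl
  σ₀^-apply (suc u) z = cong (σ₀ n k a) (σ₀^-apply u z)

  σ₀-period : σ₀ n k a ^ k ≗ id
  σ₀-period z = trans (σ₀^-apply k z) (cong (proj₁ z ,_) (next-period (proj₂ z)))

  σ₁^-index : ∀ u z → proj₂ ((σ₁ n k a ^ u) z) ≡ (prev ^ u) (proj₂ z)
  σ₁^-index zero    z = refl
  σ₁^-index (suc u) z = cong prev (σ₁^-index u z)

  σ₁^-position : ∀ u m i → toℕ (proj₁ ((σ₁ n k a ^ u) (m , i))) ≡ (+ toℕ m ℤ.- + backward-sum a u i) %ℕ n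
  σ₁^-position zero    m i =
    sym (trans (cong (_%ℕ n) (ℤP.+-identityʳ (+ toℕ m))) (ℕD.m<n⇒m%n≡m (FP.toℕ<n m)))
  σ₁^-position (suc u) m i = begin
    toℕ (proj₁ (σ₁ n k a w))                        ≡⟨ FP.toℕ-fromℕ< _ ⟩
    (+ toℕ (proj₁ w) ℤ.- + a (prev (proj₂ w))) %ℕ n ≡⟨ cong₂ (λ r j → (+ r ℤ.- + a (prev j)) %ℕ n) (σ₁^-position u m i) (σ₁^-index u (m , i)) ⟩
    (+ ((+ toℕ m ℤ.- + B) %ℕ n) ℤ.- + A) %ℕ n       ≡⟨ [i%ℕn-b]%ℕn≡[i-b]%ℕn (+ toℕ m ℤ.- + B) (+ A) ⟩
    (+ toℕ m ℤ.- + B ℤ.- + A) %ℕ n                  ≡⟨ cong (_%ℕ n) (sub-sub (+ toℕ m) (+ B) (+ A)) ⟩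
    (+ toℕ m ℤ.- (+ B ℤ.+ + A)) %ℕ n                ≡⟨ cong (λ c → (+ toℕ m ℤ.- c) %ℕ n) (ℤP.pos-+ B A) ⟨
    (+ toℕ m ℤ.- + backward-sum a (suc u) i) %ℕ n   ∎
    where
    open ≡-Reasoning
    w : Edge n k
    w = (σ₁ n k a ^ u) (m , i)
    B A : ℕ
    B = backward-sum a u i
    A = a (prev ((prev ^ u) i))
    sub-sub : ∀ M P Q → M ℤ.- P ℤ.- Q ≡ M ℤ.- (P ℤ.+ Q)
    sub-sub = solve-∀

  σ₁-period : sumFin k a ≡ (k ∸ 2) ℕ.* n → σ₁ n k a ^ k ≗ id
  σ₁-period angleSum (m , i) = cong₂ _,_
    (FP.toℕ-injective (begin
      toℕ (proj₁ ((σ₁ n k a ^ k) (m , i)))    ≡⟨ σ₁^-position k m i ⟩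
      (+ toℕ m ℤ.- + backward-sum a k i) %ℕ n ≡⟨ cong (λ c → (+ toℕ m ℤ.- + c) %ℕ n) (trans (sym (sumFin≡backward-sum a i)) angleSum) ⟩
      (+ toℕ m ℤ.- + (k₂ ℕ.* n)) %ℕ n         ≡⟨ [m-qn]%ℕn≡m k₂ (FP.toℕ<n m) ⟩
      toℕ m                                      ∎))
    (trans (σ₁^-index k (m , i)) (prev-period i))
    where open ≡-Reasoning

  N-preserves-index : ∀ {f} → NSub n k a f → proj₂ ∘ f ≗ proj₂
  N-preserves-index = ⟨⟩-preserves proj₂ λ { (x , _ , _ , refl) z → begin
    proj₂ ((σ₀ n k a ^ x) ((σ₁ n k a ^ x) z)) ≡⟨ cong proj₂ (σ₀^-apply x _) ⟩
    (next ^ x) (proj₂ ((σ₁ n k a ^ x) z))     ≡⟨ cong (next ^ x) (σ₁^-index x z) ⟩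
    (next ^ x) ((prev ^ x) (proj₂ z))         ≡⟨ ^-inverseˡ {f = prev} {next} next∘prev x (proj₂ z) ⟩
    proj₂ z                                   ∎ }
    where open ≡-Reasoning

  H-preserves-position : ∀ {f} → HSub n k a f → proj₁ ∘ f ≗ proj₁
  H-preserves-position = ⟨⟩-preserves proj₁ λ { refl z → refl }

  N∩H-trivial : ∀ {f} → NSub n k a f → HSub n k a f → f ≗ id
  N∩H-trivial nf hf z = cong₂ _,_ (H-preserves-position hf z) (N-preserves-index nf z)

theorem1 : (k n : ℕ) .{{_ : NonZero n}} .{{_ : NonZero k}} → 3 ≤ k →
    (a : Fin k → ℕ) → IsKGon n k a →
    ((∀ f → NSub n k a f → MonodromyGroup n k a f) ×
     (∀ g g⁻¹ f → MonodromyGroup n k a g →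
        (∀ x → g⁻¹ (g x) ≡ x) → (∀ x → g (g⁻¹ x) ≡ x) →
        NSub n k a f → NSub n k a (g ∘ f ∘ g⁻¹)))
    × (∀ f → NSub n k a f → HSub n k a f → ∀ x → f x ≡ x)
    × (∀ f g → NSub n k a f → HSub n k a g → MonodromyGroup n k a (f ∘ g))
    × (∀ h → MonodromyGroup n k a h →
        ∃₂ λ f g → NSub n k a f × HSub n k a g × (∀ x → h x ≡ f (g x)))
theorem1 k@(suc (suc k₂)) n (s≤s (s≤s _)) a kgon =
  ((λ _ → N⊆G) , (λ _ _ _ → N-normal)) ,
  (λ _ → N∩H-trivial) ,
  (λ _ _ nf hg → comp (N⊆G nf) (H⊆G hg)) ,
  (λ _ → G⊆NH)
  where
  open Polygon n k₂ a
  open Semidirect (σ₀ n k a) (σ₁ n k a) k₂ σ₀-period (σ₁-period (IsKGon.angleSum kgon))
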